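{- For all integers $n\geq1$ and $m\geq1$ there is a Henkin (Henkin–Asser) structure of second order that is a model of every axiom $choice_h^{n,m}(H)$, where $H(\mathbf{x},D)$ ranges over all second-order formulas in which at most $x_1,\ldots,x_n$ and the $m$-ary predicate variable $D$ occur free (and only free), and which is also a model of $\neg WO^1$.
   Context: Second-order language: many-sorted first-order language with identity, individual variables (sort $0$), predicate variables of each sort $n\ge1$ ($n$-ary), atomic formulas $x_i=x_j$, $A=B$ (same sort), $A x_1\cdots x_n$; closed under connectives and quantifiers over both kinds of variables. A predicate structure $(J_n)_{n\ge0}$: a nonempty set $J_0$ of individuals and for each $n\ge1$ a nonempty set $J_n$ of $n$-ary predicates (functions $J_0^n\to\{true,false\}$) on $J_0$; variables of sort $n$ range over $J_n$, $Ax_1\cdots x_n$ is true iff the assigned predicate is true at the assigned tuple, and $=$ is real equality. A Henkin structure of second order is a predicate structure satisfying all comprehension axioms $\exists A\,\forall x_1\cdots\forall x_n\,(Ax_1\cdots x_n\leftrightarrow H)$ for all formulas $H$ in which $A$ does not occur (equivalently: every predicate second-order definable in the structure from parameters in the structure belongs to it). With $\mathbf{x}=x_1,\ldots,x_n$, $\mathbf{y}=y_1,\ldots,y_m$, $D$ of sort $m$, $S$ of sort $n+m$: $choice_h^{n,m}(H)=\forall \mathbf{x}\exists D\,H(\mathbf{x},D)\to\exists S\forall\mathbf{x}\exists D(\forall\mathbf{y}(D\mathbf{y}\leftrightarrow S\mathbf{x}\mathbf{y})\wedge H(\mathbf{x},D))$. $WO^1$ denotes the second-order well-ordering principle for unary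 predicates: for every unary predicate variable $A$ there exists a binary predicate $T$ such that $T$ restricted to $A$ is a (strict or reflexive) linear order of $A$ and every unary predicate $B$ with $\exists x Bx$ and $\forall x(Bx\to Ax)$ has a $T$-least element. -}

module Defs where

open import Data.Nat using (ℕ; zero; suc; _+_; _∸_; _<_; _≤_; pred; _≟_)
open import Data.Bool using (Bool; true)
open import Data.Vec using (Vec; []; _∷_; foldr)
open import Data.List using (List; []; _∷_)
open import Data.List.Membership.Propositional using (_∈_)
open import Data.Vec.Relation.Unary.All using (All)
open import Data.Product using (Σ; _×_; _,_)
open import Data.Sum using (_⊎_)
open import Data.Empty using (⊥)
open import Relation.Nullary using (¬_; yes; no)
open import Relation.Binary.PropositionalEquality using (_≡_; refl)
open import Data.Vec using (map; _++_)
import Data.Unit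
open import Data.Product using (proj₁)

-- A predicate variable of sort (suc k) (i.e. (suc k)-ary) is named by
-- a pair (k , a) : the sort code k and an index a : ℕ.

data Formula : Set where
  eqI  : ℕ → ℕ → Formula
  eqP  : (k : ℕ) → ℕ → ℕ → Formula
  app  : (k : ℕ) → ℕ → Vec ℕ (suc k) → Formula
  falsum : Formula
  neg  : Formula → Formula
  _∧'_ : Formula → Formula → Formula
  _∨'_ : Formula → Formula → Formula
  _⇒'_ : Formula → Formula → Formula
  _⇔'_ : Formula → Formula → Formula
  allI : ℕ → Formula → Formula
  exI  : ℕ → Formula → Formula
  allP : (k : ℕ) → ℕ → Formula → Formula
  exP  : (k : ℕ) → ℕ → Formula → Formula

infixr 6 _∧'_
infixr 5 _∨'_
infixr 4 _⇒'_ _⇔'_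

record PredStructure : Set₁ where
  field
    J0       : Set
    j0       : J0
    Mem      : (k : ℕ) → (Vec J0 (suc k) → Bool) → Set
    Mem-ext  : ∀ k (P Q : Vec J0 (suc k) → Bool) →
               Mem k P → (∀ v → P v ≡ Q v) → Mem k Q
    Mem-inh  : ∀ k → Σ (Vec J0 (suc k) → Bool) (Mem k)

  Pred : ℕ → Set
  Pred k = Σ (Vec J0 (suc k) → Bool) (Mem k)

open PredStructure public

record Assignment (S : PredStructure) : Set where
  field
    ind : ℕ → J0 S
    prd : (k : ℕ) → ℕ → Pred S k
open Assignment public

module _ {S : PredStructure} where

  setI : Assignment S → ℕ → J0 S → Assignment S
  setI ρ i d = record { ind = f ; prd = prd ρ }
    where
    f : ℕ → J0 S
    f j with j ≟ i
    ... | yes _ = d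
    ... | no _  = ind ρ j

  setP : Assignment S → (k : ℕ) → ℕ → Pred S k → Assignment S
  setP ρ k a P = record { ind = ind ρ ; prd = g }
    where
    g : (k' : ℕ) → ℕ → Pred S k'
    g k' a' with k' ≟ k
    ... | no _ = prd ρ k' a'
    ... | yes refl with a' ≟ a
    ...   | yes _ = P
    ...   | no _  = prd ρ k' a'

  -- Tarskian satisfaction, read classically via the Gödel–Gentzen
  -- negative translation (∃ and ∨ are double-negated, individual
  -- equality atoms are double-negated; the other atoms are already
  -- ¬¬-stable).  Under classical logic this is the usual satisfaction.
  sat : Assignment S → Formula → Set
  sat ρ (eqI i j)    = ¬ ¬ (ind ρ i ≡ ind ρ j)
  sat ρ (eqP k a b)  = ∀ v → proj₁ (prd ρ k a) v ≡ proj₁ (prd ρ k b) v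
  sat ρ (app k a xs) = proj₁ (prd ρ k a) (map (ind ρ) xs) ≡ true
  sat ρ falsum       = ⊥
  sat ρ (neg F)      = ¬ sat ρ F
  sat ρ (F ∧' G)     = sat ρ F × sat ρ G
  sat ρ (F ∨' G)     = ¬ ¬ (sat ρ F ⊎ sat ρ G)
  sat ρ (F ⇒' G)     = sat ρ F → sat ρ G
  sat ρ (F ⇔' G)     = (sat ρ F → sat ρ G) × (sat ρ G → sat ρ F)
  sat ρ (allI i F)   = (d : J0 S) → sat (setI ρ i d) F
  sat ρ (exI i F)    = ¬ ¬ Σ (J0 S) (λ d → sat (setI ρ i d) F)
  sat ρ (allP k a F) = (P : Pred S k) → sat (setP ρ k a P) F
  sat ρ (exP k a F)  = ¬ ¬ Σ (Pred S k) (λ P → sat (setP ρ k a P) F)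

_⊨_ : PredStructure → Formula → Set
S ⊨ F = (ρ : Assignment S) → sat ρ F

allIs : ∀ {r} → Vec ℕ r → Formula → Formula
allIs xs F = foldr _ allI F xs

exIs : ∀ {r} → Vec ℕ r → Formula → Formula
exIs xs F = foldr _ exI F xs

vars : (s r : ℕ) → Vec ℕ r
vars s zero    = []
vars s (suc r) = s ∷ vars (suc s) r

OccursP : ℕ → ℕ → Formula → Set
OccursP k a (eqI _ _)     = ⊥
OccursP k a (eqP k' b c)  = (k ≡ k' × a ≡ b) ⊎ (k ≡ k' × a ≡ c)
OccursP k a (app k' b _)  = k ≡ k' × a ≡ b
OccursP k a falsum        = ⊥
OccursP k a (neg F)       = OccursP k a F
OccursP k a (F ∧' G)      = OccursP k a F ⊎ OccursP k a G
OccursP k a (F ∨' G)      = OccursP k a F ⊎ OccursP k a G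
OccursP k a (F ⇒' G)      = OccursP k a F ⊎ OccursP k a G
OccursP k a (F ⇔' G)      = OccursP k a F ⊎ OccursP k a G
OccursP k a (allI _ F)    = OccursP k a F
OccursP k a (exI _ F)     = OccursP k a F
OccursP k a (allP k' b F) = (k ≡ k' × a ≡ b) ⊎ OccursP k a F
OccursP k a (exP k' b F)  = (k ≡ k' × a ≡ b) ⊎ OccursP k a F

comprehension : (k a : ℕ) → Vec ℕ (suc k) → Formula → Formula
comprehension k a xs H = exP k a (allIs xs (app k a xs ⇔' H))

IsHenkin : PredStructure → Set
IsHenkin S = (k a : ℕ) (xs : Vec ℕ (suc k)) (H : Formula) →
             ¬ OccursP k a H → S ⊨ comprehension k a xs H

-- choice_h^{n,m}(H), for n, m ≥ 1.
-- Conventions: x_1..x_n are the individual variables 0..n-1,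
-- y_1..y_m are the individual variables n..n+m-1,
-- D is the predicate variable of sort m with index 0, i.e. (m ∸ 1 , 0),
-- S is the predicate variable of sort n+m with index 0, i.e. (n + m ∸ 1 , 0).

choice : (n m : ℕ) → Formula → Formula
choice n m H =
  allIs xs (exP dk 0 H)
  ⇒' exP sk 0 (allIs xs (exP dk 0
        (allIs ys (app dk 0 (cast ys) ⇔' app sk 0 (cast (xs ++ ys))) ∧' H)))
  where
  dk = m ∸ 1
  sk = n + m ∸ 1
  xs = vars 0 n
  ys = vars n m
  cast : ∀ {r} → Vec ℕ r → Vec ℕ (suc (r ∸ 1))
  cast {zero}  v = 0 ∷ []       -- not used when n, m ≥ 1
  cast {suc r} v = v

-- H is admissible for choice^{n,m}: its free variables are among
-- x_1..x_n (individual variables < n) and D (predicate variable (m ∸ 1 , 0)),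
-- and these variables occur only free (never quantified) in H.
-- BI / BP are the individual / predicate variables bound so far.
AdmissibleIn : (n m : ℕ) → List ℕ → List (ℕ × ℕ) → Formula → Set
AdmissibleIn n m BI BP (eqI i j)    = OkI i × OkI j
  where OkI : ℕ → Set
        OkI i = i ∈ BI ⊎ i < n
AdmissibleIn n m BI BP (eqP k a b)  = OkP a × OkP b
  where OkP : ℕ → Set
        OkP a = (k , a) ∈ BP ⊎ (k ≡ m ∸ 1 × a ≡ 0)
AdmissibleIn n m BI BP (app k a xs) =
  ((k , a) ∈ BP ⊎ (k ≡ m ∸ 1 × a ≡ 0)) × All (λ i → i ∈ BI ⊎ i < n) xs
AdmissibleIn n m BI BP falsum       = Data.Unit.⊤
AdmissibleIn n m BI BP (neg F)      = AdmissibleIn n m BI BP F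
AdmissibleIn n m BI BP (F ∧' G)     = AdmissibleIn n m BI BP F × AdmissibleIn n m BI BP G
AdmissibleIn n m BI BP (F ∨' G)     = AdmissibleIn n m BI BP F × AdmissibleIn n m BI BP G
AdmissibleIn n m BI BP (F ⇒' G)     = AdmissibleIn n m BI BP F × AdmissibleIn n m BI BP G
AdmissibleIn n m BI BP (F ⇔' G)     = AdmissibleIn n m BI BP F × AdmissibleIn n m BI BP G
AdmissibleIn n m BI BP (allI i F)   = n ≤ i × AdmissibleIn n m (i ∷ BI) BP F
AdmissibleIn n m BI BP (exI i F)    = n ≤ i × AdmissibleIn n m (i ∷ BI) BP F
AdmissibleIn n m BI BP (allP k a F) = ¬ (k ≡ m ∸ 1 × a ≡ 0) × AdmissibleIn n m BI ((k , a) ∷ BP) F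
AdmissibleIn n m BI BP (exP k a F)  = ¬ (k ≡ m ∸ 1 × a ≡ 0) × AdmissibleIn n m BI ((k , a) ∷ BP) F

Admissible : (n m : ℕ) → Formula → Set
Admissible n m H = AdmissibleIn n m [] [] H

-- WO^1 (strict-order version).  A : unary (0 , 0), T : binary (1 , 0),
-- B : unary (0 , 1); individual variables x = 0, y = 1, z = 2.

private
  A : ℕ → Formula
  A i = app 0 0 (i ∷ [])
  B : ℕ → Formula
  B i = app 0 1 (i ∷ [])
  T : ℕ → ℕ → Formula
  T i j = app 1 0 (i ∷ j ∷ [])

strictLinOnA : Formula
strictLinOnA =
  allI 0 (A 0 ⇒' neg (T 0 0))
  ∧' allI 0 (allI 1 (allI 2 ((A 0 ∧' A 1 ∧' A 2 ∧' T 0 1 ∧' T 1 2) ⇒' T 0 2)))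
  ∧' allI 0 (allI 1 ((A 0 ∧' A 1) ⇒' (T 0 1 ∨' eqI 0 1 ∨' T 1 0)))

leastElements : Formula
leastElements =
  allP 0 1 ((exI 0 (B 0) ∧' allI 0 (B 0 ⇒' A 0))
            ⇒' exI 0 (B 0 ∧' allI 1 (B 1 ⇒' (eqI 0 1 ∨' T 0 1))))

WO1 : Formula
WO1 = allP 0 0 (exP 1 0 (strictLinOnA ∧' leastElements))

module Submission where

-- The model is the permutation model on ℕ: its predicates are the relations with finite support,
-- i.e. invariant under all permutations fixing some initial segment [0, L). Satisfaction is
-- invariant under permutations, so a formula with parameters below L defines a relation supported
-- by L. Such a relation is determined by its values on the finitely many tuples in normal form
-- (entries below L plus the arity), and fixing those values is a finite choice, which is available
-- under the double-negation reading of satisfaction; this gives comprehension. For choice, witnesses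
-- D are chosen only for the finitely many x ∈ [0, n)ⁿ and carried to every other x by the permutation
-- normalising x; all of them are supported below one bound, so the resulting S has finite support.
-- WO¹ fails for the full unary predicate: two points outside the support of a binary T are swapped
-- by a permutation fixing that support, so T cannot order them.

open import Defs
open import Data.Nat using (ℕ; zero; suc; _+_; _∸_; _<_; _≤_; _≟_; _<?_; z≤n; s≤s; _⊔_)
open import Data.Nat.Properties
open import Data.Bool using (Bool; true; false)
open import Data.Vec using (Vec; []; _∷_; map; _++_; take; drop)
open import Data.Vec.Properties
  using (map-∘; map-cong; map-id; map-++; take-map; drop-map; take++drop≡id; ++-injectiveˡ; ++-injectiveʳ)
open import Data.Vec.Membership.Propositional using () renaming (_∈_ to _∈ᵥ_)
open import Data.Vec.Membership.Propositional.Properties using (∈-map⁺)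
open import Data.Vec.Membership.DecPropositional _≟_ using (_∈?_)
open import Data.Vec.Relation.Unary.Any using (here; there)
open import Data.Vec.Relation.Unary.All using (All; []; _∷_; all?)
import Data.Vec.Relation.Unary.All as All
open import Data.Vec.Relation.Unary.All.Properties using (map⁺)
open import Data.List using (List; []; _∷_)
open import Data.List.Membership.Propositional using () renaming (_∈_ to _∈ₗ_)
open import Data.List.Relation.Unary.Any using (here; there)
open import Data.Product using (Σ; _×_; _,_; proj₁; proj₂)
open import Data.Sum using (_⊎_; inj₁; inj₂; [_,_]′)
import Data.Sum as Sum
open import Data.Empty using (⊥; ⊥-elim)
open import Function using (_∘_)
open import Function.Bundles using (Inverse; _↔_; mk↔ₛ′)
open import Function.Construct.Composition using (_↔-∘_)
open import Function.Construct.Symmetry using (↔-sym)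
open import Function.Construct.Identity using (↔-id)
open import Level using (0ℓ)
open import Relation.Nullary using (¬_; yes; no; Dec)
open import Relation.Nullary.Negation using (¬¬-map; ¬¬-Monad)
open import Relation.Nullary.Decidable using (¬¬-excluded-middle)
open import Relation.Binary.PropositionalEquality
open import Effect.Monad using (RawMonad)

open Inverse using (to; from; strictlyInverseˡ; strictlyInverseʳ)
open RawMonad (¬¬-Monad {0ℓ}) using (_>>=_; pure)

Perm : Set
Perm = ℕ ↔ ℕ

FixesBelow : ℕ → Perm → Set
FixesBelow L π = ∀ a → a < L → to π a ≡ a

Below : ℕ → ∀ {r} → Vec ℕ r → Set
Below B = All (_< B)

fixesBelow-sym : ∀ {L} (π : Perm) → FixesBelow L π → FixesBelow L (↔-sym π)
fixesBelow-sym π fix a a<L = trans (cong (from π) (sym (fix a a<L))) (strictlyInverseʳ π a)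

fixesBelow-∘ : ∀ {L} (π σ : Perm) → FixesBelow L π → FixesBelow L σ → FixesBelow L (π ↔-∘ σ)
fixesBelow-∘ π σ fixπ fixσ a a<L = trans (cong (to π) (fixσ a a<L)) (fixπ a a<L)

fixesBelow-mono : ∀ {L L'} (π : Perm) → L ≤ L' → FixesBelow L' π → FixesBelow L π
fixesBelow-mono π L≤L' fix a a<L = fix a (<-≤-trans a<L L≤L')

to-injective : (π : Perm) {a b : ℕ} → to π a ≡ to π b → a ≡ b
to-injective π {a} {b} πa≡πb =
  trans (sym (strictlyInverseʳ π a)) (trans (cong (from π) πa≡πb) (strictlyInverseʳ π b))

fixesBelow-reflects-< : ∀ {L a} (π : Perm) → FixesBelow L π → to π a < L → a < L
fixesBelow-reflects-< {L} π fix πa<L = subst (_< L) (to-injective π (fix _ πa<L)) πa<L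

map-fixesBelow : ∀ {r L} (π : Perm) (v : Vec ℕ r) → FixesBelow L π → Below L v → map (to π) v ≡ v
map-fixesBelow π []      fix []         = refl
map-fixesBelow π (x ∷ v) fix (x<L ∷ v<L) = cong₂ _∷_ (fix x x<L) (map-fixesBelow π v fix v<L)

map-from-to : ∀ {r} (π : Perm) (v : Vec ℕ r) → map (from π) (map (to π) v) ≡ v
map-from-to π v = trans (sym (map-∘ (from π) (to π) v)) (trans (map-cong (strictlyInverseʳ π) v) (map-id v))

map-to-from : ∀ {r} (π : Perm) (v : Vec ℕ r) → map (to π) (map (from π) v) ≡ v
map-to-from π = map-from-to (↔-sym π)

transpose : ℕ → ℕ → ℕ → ℕ
transpose a b x with x ≟ a
... | yes _ = b
... | no _ with x ≟ b
...   | yes _ = a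
...   | no _  = x

transpose-left : ∀ a b → transpose a b a ≡ b
transpose-left a b with a ≟ a
... | yes _   = refl
... | no a≢a = ⊥-elim (a≢a refl)

transpose-right : ∀ a b → transpose a b b ≡ a
transpose-right a b with b ≟ a
... | yes b≡a = b≡a
... | no _ with b ≟ b
...   | yes _   = refl
...   | no b≢b = ⊥-elim (b≢b refl)

transpose-other : ∀ {a b x} → x ≢ a → x ≢ b → transpose a b x ≡ x
transpose-other {a} {b} {x} x≢a x≢b with x ≟ a
... | yes x≡a = ⊥-elim (x≢a x≡a)
... | no _ with x ≟ b
...   | yes x≡b = ⊥-elim (x≢b x≡b)
...   | no _    = refl

transpose-involutive : ∀ a b x → transpose a b (transpose a b x) ≡ x
transpose-involutive a b x with x ≟ a
... | yes refl = transpose-right x b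
... | no x≢a with x ≟ b
...   | yes refl = transpose-left a x
...   | no x≢b   = transpose-other x≢a x≢b

transpose-< : ∀ {B a b x} → a < B → b < B → x < B → transpose a b x < B
transpose-< {a = a} {b} {x} a<B b<B x<B with x ≟ a
... | yes _ = b<B
... | no _ with x ≟ b
...   | yes _ = a<B
...   | no _  = x<B

transposition : ℕ → ℕ → Perm
transposition a b = mk↔ₛ′ (transpose a b) (transpose a b) (transpose-involutive a b) (transpose-involutive a b)

transposition-fixesBelow : ∀ {L a b} → L ≤ a → L ≤ b → FixesBelow L (transposition a b)
transposition-fixesBelow L≤a L≤b x x<L =
  transpose-other (<⇒≢ (<-≤-trans x<L L≤a)) (<⇒≢ (<-≤-trans x<L L≤b))

transposed-fixesBelow : ∀ {t a} (π : Perm) → FixesBelow t π → t ≤ a → t ≤ to π a →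
                        FixesBelow (suc t) (transposition (to π a) t ↔-∘ (π ↔-∘ transposition a t))
transposed-fixesBelow {t} {a} π fix t≤a t≤πa x x<1+t with x ≟ t
... | yes refl = trans (cong (transpose (to π a) x ∘ to π) (transpose-right a x)) (transpose-left (to π a) x)
... | no x≢t   = trans (cong (transpose (to π a) t ∘ to π) (transpose-other x≢a x≢t))
                       (trans (cong (transpose (to π a) t) (fix x x<t)) (transpose-other x≢πa x≢t))
  where
  x<t : x < t
  x<t = ≤∧≢⇒< (≤-pred x<1+t) x≢t
  x≢a : x ≢ a
  x≢a = <⇒≢ (<-≤-trans x<t t≤a)
  x≢πa : x ≢ to π a
  x≢πa = <⇒≢ (<-≤-trans x<t t≤πa)

-- The permutation model

Supported : ∀ {r} → ℕ → (Vec ℕ r → Bool) → Set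
Supported L P = ∀ π → FixesBelow L π → ∀ v → P (map (to π) v) ≡ P v

FinitelySupported : (k : ℕ) → (Vec ℕ (suc k) → Bool) → Set
FinitelySupported k P = Σ ℕ λ L → Supported L P

supportModel : PredStructure
supportModel = record
  { J0      = ℕ
  ; j0      = 0
  ; Mem     = FinitelySupported
  ; Mem-ext = λ k P Q (L , supp) P≗Q → L , λ π fix v → trans (sym (P≗Q _)) (trans (supp π fix v) (P≗Q v))
  ; Mem-inh = λ k → (λ _ → true) , 0 , λ _ _ _ → refl
  }

SPred : ℕ → Set
SPred = Pred supportModel

support : ∀ {k} → SPred k → ℕ
support P = proj₁ (proj₂ P)

support-supported : ∀ {k} (P : SPred k) → Supported (support P) (proj₁ P)
support-supported P = proj₂ (proj₂ P)

upperBound : ℕ → (ℕ → ℕ) → ℕ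
upperBound zero    h = 0
upperBound (suc L) h = suc (h L) ⊔ upperBound L h

<-upperBound : ∀ L h {a} → a < L → h a < upperBound L h
<-upperBound (suc L) h {a} a<1+L with a ≟ L
... | yes refl = m≤m⊔n (suc (h a)) (upperBound L h)
... | no a≢L   =
  <-≤-trans (<-upperBound L h (≤∧≢⇒< (≤-pred a<1+L) a≢L)) (m≤n⊔m (suc (h L)) (upperBound L h))

conjugate : Perm → Perm → Perm
conjugate π σ = ↔-sym π ↔-∘ (σ ↔-∘ π)

conjugate-fixesBelow : ∀ {L} (π σ : Perm) → FixesBelow (upperBound L (to π)) σ → FixesBelow L (conjugate π σ)
conjugate-fixesBelow {L} π σ fix a a<L =
  trans (cong (from π) (fix (to π a) (<-upperBound L (to π) a<L))) (strictlyInverseʳ π a)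

map-conjugate : ∀ {r} (π σ : Perm) (v : Vec ℕ r) →
                map (from π) (map (to σ) v) ≡ map (to (conjugate π σ)) (map (from π) v)
map-conjugate π σ v = begin
  map (from π) (map (to σ) v)                ≡⟨ map-∘ (from π) (to σ) v ⟨
  map (from π ∘ to σ) v                      ≡⟨ map-cong (cong (from π ∘ to σ) ∘ strictlyInverseˡ π) v ⟨
  map (to (conjugate π σ) ∘ from π) v        ≡⟨ map-∘ (to (conjugate π σ)) (from π) v ⟩
  map (to (conjugate π σ)) (map (from π) v)  ∎
  where open ≡-Reasoning

permute : ∀ {k} → Perm → SPred k → SPred k
permute π P = proj₁ P ∘ map (from π) , upperBound (support P) (to π) , supported
  where
  supported : Supported (upperBound (support P) (to π)) (proj₁ P ∘ map (from π))
  supported σ fix v =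
    trans (cong (proj₁ P) (map-conjugate π σ v))
          (support-supported P (conjugate π σ) (conjugate-fixesBelow π σ fix) (map (from π) v))

-- Free variables and the coincidence lemma

FreeI : ℕ → Formula → Set
FreeI j (eqI a b)    = j ≡ a ⊎ j ≡ b
FreeI j (eqP _ _ _)  = ⊥
FreeI j (app _ _ xs) = j ∈ᵥ xs
FreeI j falsum       = ⊥
FreeI j (neg F)      = FreeI j F
FreeI j (F ∧' G)     = FreeI j F ⊎ FreeI j G
FreeI j (F ∨' G)     = FreeI j F ⊎ FreeI j G
FreeI j (F ⇒' G)     = FreeI j F ⊎ FreeI j G
FreeI j (F ⇔' G)     = FreeI j F ⊎ FreeI j G
FreeI j (allI i F)   = j ≢ i × FreeI j F
FreeI j (exI i F)    = j ≢ i × FreeI j F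
FreeI j (allP _ _ F) = FreeI j F
FreeI j (exP _ _ F)  = FreeI j F

FreeP : ℕ → ℕ → Formula → Set
FreeP k a (eqI _ _)     = ⊥
FreeP k a (eqP k' b c)  = (k ≡ k' × a ≡ b) ⊎ (k ≡ k' × a ≡ c)
FreeP k a (app k' b _)  = k ≡ k' × a ≡ b
FreeP k a falsum        = ⊥
FreeP k a (neg F)       = FreeP k a F
FreeP k a (F ∧' G)      = FreeP k a F ⊎ FreeP k a G
FreeP k a (F ∨' G)      = FreeP k a F ⊎ FreeP k a G
FreeP k a (F ⇒' G)      = FreeP k a F ⊎ FreeP k a G
FreeP k a (F ⇔' G)      = FreeP k a F ⊎ FreeP k a G
FreeP k a (allI _ F)    = FreeP k a F
FreeP k a (exI _ F)     = FreeP k a F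
FreeP k a (allP k' b F) = ¬ (k ≡ k' × a ≡ b) × FreeP k a F
FreeP k a (exP k' b F)  = ¬ (k ≡ k' × a ≡ b) × FreeP k a F

freeP⇒occursP : ∀ k a F → FreeP k a F → OccursP k a F
freeP⇒occursP k a (eqP _ _ _)  = λ free → free
freeP⇒occursP k a (app _ _ _)  = λ free → free
freeP⇒occursP k a (neg F)      = freeP⇒occursP k a F
freeP⇒occursP k a (F ∧' G)     = Sum.map (freeP⇒occursP k a F) (freeP⇒occursP k a G)
freeP⇒occursP k a (F ∨' G)     = Sum.map (freeP⇒occursP k a F) (freeP⇒occursP k a G)
freeP⇒occursP k a (F ⇒' G)     = Sum.map (freeP⇒occursP k a F) (freeP⇒occursP k a G)
freeP⇒occursP k a (F ⇔' G)     = Sum.map (freeP⇒occursP k a F) (freeP⇒occursP k a G)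
freeP⇒occursP k a (allI _ F)   = freeP⇒occursP k a F
freeP⇒occursP k a (exI _ F)    = freeP⇒occursP k a F
freeP⇒occursP k a (allP _ _ F) = inj₂ ∘ freeP⇒occursP k a F ∘ proj₂
freeP⇒occursP k a (exP _ _ F)  = inj₂ ∘ freeP⇒occursP k a F ∘ proj₂

module _ {S : PredStructure} where

  setI-same : ∀ (ρ : Assignment S) i d → ind (setI ρ i d) i ≡ d
  setI-same ρ i d with i ≟ i
  ... | yes _   = refl
  ... | no i≢i = ⊥-elim (i≢i refl)

  setI-other : ∀ (ρ : Assignment S) {i j} d → j ≢ i → ind (setI ρ i d) j ≡ ind ρ j
  setI-other ρ {i} {j} d j≢i with j ≟ i
  ... | yes j≡i = ⊥-elim (j≢i j≡i)
  ... | no _    = refl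

  setP-same : ∀ (ρ : Assignment S) k a P → prd (setP ρ k a P) k a ≡ P
  setP-same ρ k a P with k ≟ k
  ... | no k≢k = ⊥-elim (k≢k refl)
  ... | yes refl with a ≟ a
  ...   | yes _   = refl
  ...   | no a≢a = ⊥-elim (a≢a refl)

  setP-other : ∀ (ρ : Assignment S) {k a k' a'} P → ¬ (k' ≡ k × a' ≡ a) →
               prd (setP ρ k a P) k' a' ≡ prd ρ k' a'
  setP-other ρ {k} {a} {k'} {a'} P other with k' ≟ k
  ... | no _ = refl
  ... | yes refl with a' ≟ a
  ...   | yes a'≡a = ⊥-elim (other (refl , a'≡a))
  ...   | no _     = refl

  setI-cong : ∀ {ρ ρ' : Assignment S} i d j → (j ≢ i → ind ρ j ≡ ind ρ' j) →
              ind (setI ρ i d) j ≡ ind (setI ρ' i d) j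
  setI-cong {ρ} {ρ'} i d j agree = byCases (j ≟ i)
    where
    byCases : Dec (j ≡ i) → ind (setI ρ i d) j ≡ ind (setI ρ' i d) j
    byCases (yes refl) = trans (setI-same ρ j d) (sym (setI-same ρ' j d))
    byCases (no j≢i)   = trans (setI-other ρ d j≢i) (trans (agree j≢i) (sym (setI-other ρ' d j≢i)))

  setP-cong : ∀ {ρ ρ' : Assignment S} {k} a {P Q : Pred S k} k' a' → proj₁ P ≗ proj₁ Q →
              (¬ (k' ≡ k × a' ≡ a) → proj₁ (prd ρ k' a') ≗ proj₁ (prd ρ' k' a')) →
              proj₁ (prd (setP ρ k a P) k' a') ≗ proj₁ (prd (setP ρ' k a Q) k' a')
  setP-cong {ρ} {ρ'} {k} a {P} {Q} k' a' P≗Q agree = byCases (k' ≟ k) (a' ≟ a)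
    where
    other : ¬ (k' ≡ k × a' ≡ a) → proj₁ (prd (setP ρ k a P) k' a') ≗ proj₁ (prd (setP ρ' k a Q) k' a')
    other ne v = trans (cong (λ R → proj₁ R v) (setP-other ρ P ne))
                       (trans (agree ne v) (cong (λ R → proj₁ R v) (sym (setP-other ρ' Q ne))))
    byCases : Dec (k' ≡ k) → Dec (a' ≡ a) →
              proj₁ (prd (setP ρ k a P) k' a') ≗ proj₁ (prd (setP ρ' k a Q) k' a')
    byCases (yes refl) (yes refl) v = trans (cong (λ R → proj₁ R v) (setP-same ρ k a P))
                                            (trans (P≗Q v) (cong (λ R → proj₁ R v) (sym (setP-same ρ' k a Q))))
    byCases (yes _)    (no a'≢a)    = other (a'≢a ∘ proj₂)
    byCases (no k'≢k)  _            = other (k'≢k ∘ proj₁)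

  record Agree (VI : ℕ → Set) (VP : ℕ → ℕ → Set) (ρ ρ' : Assignment S) : Set where
    field
      ind-agree : ∀ j → VI j → ind ρ j ≡ ind ρ' j
      prd-agree : ∀ k a → VP k a → proj₁ (prd ρ k a) ≗ proj₁ (prd ρ' k a)
  open Agree public

  AgreeOn : Formula → Assignment S → Assignment S → Set
  AgreeOn F = Agree (λ j → FreeI j F) (λ k a → FreeP k a F)

  private variable
    VI VI' : ℕ → Set
    VP VP' : ℕ → ℕ → Set
    ρ ρ' : Assignment S

  agree-sym : Agree VI VP ρ ρ' → Agree VI VP ρ' ρ
  agree-sym agree = record
    { ind-agree = λ j v → sym (ind-agree agree j v)
    ; prd-agree = λ k a v x → sym (prd-agree agree k a v x) }

  agree-inj₁ : Agree (λ j → VI j ⊎ VI' j) (λ k a → VP k a ⊎ VP' k a) ρ ρ' → Agree VI VP ρ ρ'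
  agree-inj₁ agree = record
    { ind-agree = λ j v → ind-agree agree j (inj₁ v)
    ; prd-agree = λ k a v → prd-agree agree k a (inj₁ v) }

  agree-inj₂ : Agree (λ j → VI j ⊎ VI' j) (λ k a → VP k a ⊎ VP' k a) ρ ρ' → Agree VI' VP' ρ ρ'
  agree-inj₂ agree = record
    { ind-agree = λ j v → ind-agree agree j (inj₂ v)
    ; prd-agree = λ k a v → prd-agree agree k a (inj₂ v) }

  agree-setI : ∀ {i} d → Agree (λ j → j ≢ i × VI j) VP ρ ρ' → Agree VI VP (setI ρ i d) (setI ρ' i d)
  agree-setI {i = i} d agree = record
    { ind-agree = λ j v → setI-cong i d j (λ j≢i → ind-agree agree j (j≢i , v))
    ; prd-agree = prd-agree agree }

  agree-setP : ∀ {k a} {P Q : Pred S k} → proj₁ P ≗ proj₁ Q →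
               Agree VI (λ k' a' → ¬ (k' ≡ k × a' ≡ a) × VP k' a') ρ ρ' →
               Agree VI VP (setP ρ k a P) (setP ρ' k a Q)
  agree-setP {a = a} P≗Q agree = record
    { ind-agree = ind-agree agree
    ; prd-agree = λ k' a' v → setP-cong a k' a' P≗Q (λ other → prd-agree agree k' a' (other , v)) }

  map-agree : ∀ {r} (h h' : ℕ → J0 S) (xs : Vec ℕ r) → (∀ j → j ∈ᵥ xs → h j ≡ h' j) →
              map h xs ≡ map h' xs
  map-agree h h' []       agree = refl
  map-agree h h' (x ∷ xs) agree =
    cong₂ _∷_ (agree x (here refl)) (map-agree h h' xs (λ j j∈xs → agree j (there j∈xs)))

  sat-coincide : ∀ F {ρ ρ'} → AgreeOn F ρ ρ' → sat ρ F → sat ρ' F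
  sat-coincide (eqI i j) agree s =
    ¬¬-map (λ e → trans (sym (ind-agree agree i (inj₁ refl))) (trans e (ind-agree agree j (inj₂ refl)))) s
  sat-coincide (eqP k a b) agree s v =
    trans (sym (prd-agree agree k a (inj₁ (refl , refl)) v)) (trans (s v) (prd-agree agree k b (inj₂ (refl , refl)) v))
  sat-coincide (app k a xs) {ρ} {ρ'} agree s =
    trans (cong (proj₁ (prd ρ' k a)) (sym (map-agree (ind ρ) (ind ρ') xs (ind-agree agree))))
          (trans (sym (prd-agree agree k a (refl , refl) (map (ind ρ) xs))) s)
  sat-coincide falsum       agree s       = s
  sat-coincide (neg F)      agree s t     = s (sat-coincide F (agree-sym agree) t)
  sat-coincide (F ∧' G)     agree (s , t) = sat-coincide F (agree-inj₁ agree) s , sat-coincide G (agree-inj₂ agree) t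
  sat-coincide (F ∨' G)     agree s       =
    ¬¬-map (Sum.map (sat-coincide F (agree-inj₁ agree)) (sat-coincide G (agree-inj₂ agree))) s
  sat-coincide (F ⇒' G)     agree s t     =
    sat-coincide G (agree-inj₂ agree) (s (sat-coincide F (agree-sym (agree-inj₁ agree)) t))
  sat-coincide (F ⇔' G)     agree (s , t) =
    (λ u → sat-coincide G (agree-inj₂ agree) (s (sat-coincide F (agree-sym (agree-inj₁ agree)) u))) ,
    (λ u → sat-coincide F (agree-inj₁ agree) (t (sat-coincide G (agree-sym (agree-inj₂ agree)) u)))
  sat-coincide (allI i F)   agree s d     = sat-coincide F (agree-setI d agree) (s d)
  sat-coincide (exI i F)    agree s       = ¬¬-map (λ (d , t) → d , sat-coincide F (agree-setI d agree) t) s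
  sat-coincide (allP k a F) agree s P     = sat-coincide F (agree-setP (λ _ → refl) agree) (s P)
  sat-coincide (exP k a F)  agree s       =
    ¬¬-map (λ (P , t) → P , sat-coincide F (agree-setP (λ _ → refl) agree) t) s

  record _≈_ (ρ ρ' : Assignment S) : Set where
    field
      ind-≡ : ∀ j → ind ρ j ≡ ind ρ' j
      prd-≗ : ∀ k a → proj₁ (prd ρ k a) ≗ proj₁ (prd ρ' k a)
  open _≈_ public

  ≈-refl : ∀ {ρ} → ρ ≈ ρ
  ≈-refl = record { ind-≡ = λ _ → refl ; prd-≗ = λ _ _ _ → refl }

  ≈-sym : ∀ {ρ ρ'} → ρ ≈ ρ' → ρ' ≈ ρ
  ≈-sym eq = record { ind-≡ = λ j → sym (ind-≡ eq j) ; prd-≗ = λ k a v → sym (prd-≗ eq k a v) }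

  ≈-trans : ∀ {ρ ρ' ρ''} → ρ ≈ ρ' → ρ' ≈ ρ'' → ρ ≈ ρ''
  ≈-trans eq eq' = record
    { ind-≡ = λ j → trans (ind-≡ eq j) (ind-≡ eq' j)
    ; prd-≗ = λ k a v → trans (prd-≗ eq k a v) (prd-≗ eq' k a v) }

  sat-≈ : ∀ F {ρ ρ'} → ρ ≈ ρ' → sat ρ F → sat ρ' F
  sat-≈ F eq = sat-coincide F record { ind-agree = λ j _ → ind-≡ eq j ; prd-agree = λ k a _ → prd-≗ eq k a }

  setP-≈ : ∀ {ρ ρ'} {k} a {P Q : Pred S k} → ρ ≈ ρ' → proj₁ P ≗ proj₁ Q → setP ρ k a P ≈ setP ρ' k a Q
  setP-≈ a eq P≗Q = record
    { ind-≡ = ind-≡ eq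
    ; prd-≗ = λ k' a' → setP-cong a k' a' P≗Q (λ _ → prd-≗ eq k' a') }

-- Satisfaction is invariant under permutations

Env : Set
Env = Assignment supportModel

permuteEnv : Perm → Env → Env
permuteEnv π ρ = record { ind = to π ∘ ind ρ ; prd = λ k a → permute π (prd ρ k a) }

permute-sym : ∀ {k} (π : Perm) (P : SPred k) → proj₁ (permute π (permute (↔-sym π) P)) ≗ proj₁ P
permute-sym π P v = cong (proj₁ P) (map-to-from π v)

permuteEnv-sym : ∀ (π : Perm) ρ → permuteEnv (↔-sym π) (permuteEnv π ρ) ≈ ρ
permuteEnv-sym π ρ = record
  { ind-≡ = λ j → strictlyInverseʳ π (ind ρ j)
  ; prd-≗ = λ k a v → cong (proj₁ (prd ρ k a)) (map-from-to π v) }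

permuteEnv-setI : ∀ (π : Perm) ρ i d → permuteEnv π (setI ρ i d) ≈ setI (permuteEnv π ρ) i (to π d)
permuteEnv-setI π ρ i d = record { ind-≡ = λ j → byCases j (j ≟ i) ; prd-≗ = λ _ _ _ → refl }
  where
  byCases : ∀ j → Dec (j ≡ i) → to π (ind (setI ρ i d) j) ≡ ind (setI (permuteEnv π ρ) i (to π d)) j
  byCases j (yes refl) = trans (cong (to π) (setI-same ρ j d)) (sym (setI-same (permuteEnv π ρ) j (to π d)))
  byCases j (no j≢i)   =
    trans (cong (to π) (setI-other ρ d j≢i)) (sym (setI-other (permuteEnv π ρ) (to π d) j≢i))

permuteEnv-setP : ∀ (π : Perm) ρ k a (P : SPred k) →
                  permuteEnv π (setP ρ k a P) ≈ setP (permuteEnv π ρ) k a (permute π P)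
permuteEnv-setP π ρ k a P = record { ind-≡ = λ _ → refl ; prd-≗ = λ k' a' → byCases k' a' (k' ≟ k) (a' ≟ a) }
  where
  πρ = permuteEnv π ρ
  other : ∀ k' a' → ¬ (k' ≡ k × a' ≡ a) →
          proj₁ (permute π (prd (setP ρ k a P) k' a')) ≗ proj₁ (prd (setP πρ k a (permute π P)) k' a')
  other k' a' ne v = trans (cong (λ R → proj₁ (permute π R) v) (setP-other ρ P ne))
                           (cong (λ R → proj₁ R v) (sym (setP-other πρ (permute π P) ne)))
  byCases : ∀ k' a' → Dec (k' ≡ k) → Dec (a' ≡ a) →
            proj₁ (permute π (prd (setP ρ k a P) k' a')) ≗ proj₁ (prd (setP πρ k a (permute π P)) k' a')
  byCases k' a' (yes refl) (yes refl) v = trans (cong (λ R → proj₁ (permute π R) v) (setP-same ρ k a P))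
                                                (cong (λ R → proj₁ R v) (sym (setP-same πρ k a (permute π P))))
  byCases k' a' (yes _)    (no a'≢a)  = other k' a' (a'≢a ∘ proj₂)
  byCases k' a' (no k'≢k)  _          = other k' a' (k'≢k ∘ proj₁)

sat-permute : ∀ F (π : Perm) {ρ} → sat ρ F → sat (permuteEnv π ρ) F

sat-unpermute : ∀ F (π : Perm) {ρ} → sat (permuteEnv π ρ) F → sat ρ F
sat-unpermute F π {ρ} s = sat-≈ F (permuteEnv-sym π ρ) (sat-permute F (↔-sym π) s)

sat-permute (eqI i j)    π s = ¬¬-map (cong (to π)) s
sat-permute (eqP k a b)  π s v = s (map (from π) v)
sat-permute (app k a xs) π {ρ} s =
  trans (cong (proj₁ (prd ρ k a)) (trans (cong (map (from π)) (map-∘ (to π) (ind ρ) xs))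
                                         (map-from-to π (map (ind ρ) xs))))
        s
sat-permute falsum       π s = s
sat-permute (neg F)      π s t = s (sat-unpermute F π t)
sat-permute (F ∧' G)     π (s , t) = sat-permute F π s , sat-permute G π t
sat-permute (F ∨' G)     π s = ¬¬-map (Sum.map (sat-permute F π) (sat-permute G π)) s
sat-permute (F ⇒' G)     π s t = sat-permute G π (s (sat-unpermute F π t))
sat-permute (F ⇔' G)     π (s , t) = (λ u → sat-permute G π (s (sat-unpermute F π u))) ,
                                     (λ u → sat-permute F π (t (sat-unpermute G π u)))
sat-permute (allI i F)   π {ρ} s d =
  subst (λ e → sat (setI (permuteEnv π ρ) i e) F) (strictlyInverseˡ π d)
        (sat-≈ F (permuteEnv-setI π ρ i (from π d)) (sat-permute F π (s (from π d))))
sat-permute (exI i F)    π {ρ} s =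
  ¬¬-map (λ (d , t) → to π d , sat-≈ F (permuteEnv-setI π ρ i d) (sat-permute F π t)) s
sat-permute (allP k a F) π {ρ} s Q =
  sat-≈ F (≈-trans (permuteEnv-setP π ρ k a P) (setP-≈ a ≈-refl (permute-sym π Q))) (sat-permute F π (s P))
  where P = permute (↔-sym π) Q
sat-permute (exP k a F)  π {ρ} s =
  ¬¬-map (λ (P , t) → permute π P , sat-≈ F (permuteEnv-setP π ρ k a P) (sat-permute F π t)) s

-- Normal forms of tuples

-- normaliser L k v moves, by transpositions, the entries of v outside [0, L + k) to the
-- slots L + k, L + k + 1, … in order of first occurrence; filled L k v is the next free slot.
normaliser : ∀ {r} → ℕ → ℕ → Vec ℕ r → Perm
normaliser L k []      = ↔-id ℕ
normaliser L k (a ∷ v) with a <? L + k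
... | yes _ = normaliser L k v
... | no _  = normaliser L (suc k) (map (transpose a (L + k)) v) ↔-∘ transposition a (L + k)

filled : ∀ {r} → ℕ → ℕ → Vec ℕ r → ℕ
filled L k []      = k
filled L k (a ∷ v) with a <? L + k
... | yes _ = filled L k v
... | no _  = filled L (suc k) (map (transpose a (L + k)) v)

normaliser-fixesBelow : ∀ {r} L k (v : Vec ℕ r) → FixesBelow (L + k) (normaliser L k v)
normaliser-fixesBelow L k []      x _ = refl
normaliser-fixesBelow L k (a ∷ v) with a <? L + k
... | yes _   = normaliser-fixesBelow L k v
... | no a≮L+k =
  fixesBelow-∘ τ (transposition a (L + k))
    (fixesBelow-mono τ (+-monoʳ-≤ L (n≤1+n k)) (normaliser-fixesBelow L (suc k) w))
    (transposition-fixesBelow (≮⇒≥ a≮L+k) ≤-refl)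
  where
  w = map (transpose a (L + k)) v
  τ = normaliser L (suc k) w

≤-filled : ∀ {r} L k (v : Vec ℕ r) → k ≤ filled L k v
≤-filled L k []      = ≤-refl
≤-filled L k (a ∷ v) with a <? L + k
... | yes _ = ≤-filled L k v
... | no _  = ≤-trans (n≤1+n k) (≤-filled L (suc k) (map (transpose a (L + k)) v))

filled-≤ : ∀ {r} L k (v : Vec ℕ r) → filled L k v ≤ k + r
filled-≤ L k []      = ≤-reflexive (sym (+-identityʳ k))
filled-≤ {suc r} L k (a ∷ v) with a <? L + k
... | yes _ = ≤-trans (filled-≤ L k v) (+-monoʳ-≤ k (n≤1+n r))
... | no _  = ≤-trans (filled-≤ L (suc k) (map (transpose a (L + k)) v)) (≤-reflexive (sym (+-suc k r)))

normaliser-< : ∀ {r} L k (v : Vec ℕ r) → Below (L + filled L k v) (map (to (normaliser L k v)) v)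
normaliser-< L k []      = []
normaliser-< L k (a ∷ v) with a <? L + k
... | yes a<L+k =
  subst (_< L + filled L k v) (sym (normaliser-fixesBelow L k v a a<L+k))
        (<-≤-trans a<L+k (+-monoʳ-≤ L (≤-filled L k v)))
  ∷ normaliser-< L k v
... | no _ = head ∷ tail
  where
  t = L + k
  w = map (transpose a t) v
  τ = normaliser L (suc k) w
  B = L + filled L (suc k) w
  t<L+1+k : t < L + suc k
  t<L+1+k = +-monoʳ-< L (n<1+n k)
  head : to τ (transpose a t a) < B
  head = subst (_< B) (sym (trans (cong (to τ) (transpose-left a t)) (normaliser-fixesBelow L (suc k) w t t<L+1+k)))
               (<-≤-trans t<L+1+k (+-monoʳ-≤ L (≤-filled L (suc k) w)))
  tail : Below B (map (to τ ∘ transpose a t) v)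
  tail = subst (Below B) (sym (map-∘ (to τ) (transpose a t) v)) (normaliser-< L (suc k) w)

normaliser-from-< : ∀ {r B} L k (v : Vec ℕ r) → Below B v → ∀ {x} → x < B → from (normaliser L k v) x < B
normaliser-from-< L k []      []          x<B = x<B
normaliser-from-< L k (a ∷ v) (a<B ∷ v<B) x<B with a <? L + k
... | yes _    = normaliser-from-< L k v v<B x<B
... | no a≮L+k =
  transpose-< a<B L+k<B (normaliser-from-< L (suc k) _ (map⁺ (All.map (transpose-< a<B L+k<B) v<B)) x<B)
  where
  L+k<B : L + k < _
  L+k<B = ≤-<-trans (≮⇒≥ a≮L+k) a<B

normalisedTwist : ∀ {r} → ℕ → ℕ → Perm → Vec ℕ r → Perm
normalisedTwist L k π v = normaliser L k (map (to π) v) ↔-∘ (π ↔-∘ ↔-sym (normaliser L k v))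

normaliser-equivariant : ∀ {r} L k (π : Perm) (v : Vec ℕ r) → FixesBelow (L + k) π →
                         filled L k (map (to π) v) ≡ filled L k v ×
                         FixesBelow (L + filled L k v) (normalisedTwist L k π v)
normaliser-equivariant L k π [] fix = refl , fix
normaliser-equivariant L k π (a ∷ v) fix with to π a <? L + k | a <? L + k
... | yes _      | yes _   = normaliser-equivariant L k π v fix
... | yes πa<L+k | no a≮L+k = ⊥-elim (a≮L+k (fixesBelow-reflects-< π fix πa<L+k))
... | no πa≮L+k  | yes a<L+k = ⊥-elim (πa≮L+k (subst (_< L + k) (sym (fix a a<L+k)) a<L+k))
... | no πa≮L+k  | no a≮L+k = trans (cong (filled L (suc k)) w'≡π'w) (proj₁ ih) , twist-fixes
  where
  t  = L + k
  a' = to π a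
  w  = map (transpose a t) v
  w' = map (transpose a' t) (map (to π) v)
  π' = transposition a' t ↔-∘ (π ↔-∘ transposition a t)
  π'-fixes : FixesBelow (L + suc k) π'
  π'-fixes =
    fixesBelow-mono π' (≤-reflexive (+-suc L k)) (transposed-fixesBelow π fix (≮⇒≥ a≮L+k) (≮⇒≥ πa≮L+k))
  w'≡π'w : w' ≡ map (to π') w
  w'≡π'w = begin
    map (transpose a' t) (map (to π) v)  ≡⟨ map-∘ (transpose a' t) (to π) v ⟨
    map (transpose a' t ∘ to π) v        ≡⟨ map-cong (cong (transpose a' t ∘ to π) ∘ transpose-involutive a t) v ⟨
    map (to π' ∘ transpose a t) v        ≡⟨ map-∘ (to π') (transpose a t) v ⟩
    map (to π') w                        ∎
    where open ≡-Reasoning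
  ih = normaliser-equivariant L (suc k) π' w π'-fixes
  twist-fixes : FixesBelow (L + filled L (suc k) w)
                  ((normaliser L (suc k) w' ↔-∘ transposition a' t) ↔-∘
                   (π ↔-∘ ↔-sym (normaliser L (suc k) w ↔-∘ transposition a t)))
  twist-fixes x x<B =
    trans (cong (λ u → to (normaliser L (suc k) u) (to π' (from (normaliser L (suc k) w) x))) w'≡π'w)
          (proj₂ ih x x<B)

fixesBelow-+0 : ∀ {L} (π : Perm) → FixesBelow L π → FixesBelow (L + 0) π
fixesBelow-+0 {L} π = fixesBelow-mono π (≤-reflexive (+-identityʳ L))

normalForm : ∀ {r} → ℕ → Vec ℕ r → Vec ℕ r
normalForm L v = map (to (normaliser L 0 v)) v

normaliser-fixesBelow₀ : ∀ {r} L (v : Vec ℕ r) → FixesBelow L (normaliser L 0 v)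
normaliser-fixesBelow₀ L v =
  fixesBelow-mono (normaliser L 0 v) (≤-reflexive (sym (+-identityʳ L))) (normaliser-fixesBelow L 0 v)

normalForm-< : ∀ {r} L (v : Vec ℕ r) → Below (L + r) (normalForm L v)
normalForm-< L v = All.map (λ x< → <-≤-trans x< (+-monoʳ-≤ L (filled-≤ L 0 v))) (normaliser-< L 0 v)

map-normalisedTwist : ∀ {r s} L k (π : Perm) (v : Vec ℕ r) (y : Vec ℕ s) →
                      map (to (normaliser L k (map (to π) v))) (map (to π) y) ≡
                      map (to (normalisedTwist L k π v)) (map (to (normaliser L k v)) y)
map-normalisedTwist L k π v y = begin
  map (to τπ) (map (to π) y)      ≡⟨ map-∘ (to τπ) (to π) y ⟨
  map (to τπ ∘ to π) y            ≡⟨ map-cong (cong (to τπ ∘ to π) ∘ strictlyInverseʳ τ) y ⟨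
  map (to ψ ∘ to τ) y             ≡⟨ map-∘ (to ψ) (to τ) y ⟩
  map (to ψ) (map (to τ) y)       ∎
  where
  open ≡-Reasoning
  τ  = normaliser L k v
  τπ = normaliser L k (map (to π) v)
  ψ  = normalisedTwist L k π v

normalForm-invariant : ∀ {r L} (π : Perm) (v : Vec ℕ r) → FixesBelow L π →
                       normalForm L (map (to π) v) ≡ normalForm L v
normalForm-invariant {L = L} π v fix =
  trans (map-normalisedTwist L 0 π v v)
        (map-fixesBelow ψ (normalForm L v) (proj₂ (normaliser-equivariant L 0 π v (fixesBelow-+0 π fix)))
                        (normaliser-< L 0 v))
  where
  ψ : Perm
  ψ = normalisedTwist L 0 π v

-- Finite choice under double negation

¬¬-∀< : ∀ B {P : ℕ → Set} → (∀ c → c < B → ¬ ¬ P c) → ¬ ¬ (∀ c → c < B → P c)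
¬¬-∀< zero    hyp = pure λ _ ()
¬¬-∀< (suc B) {P} hyp = do
  below ← ¬¬-∀< B (λ c c<B → hyp c (m<n⇒m<1+n c<B))
  top   ← hyp B (n<1+n B)
  pure λ c c<1+B → extend below top c (c ≟ B) c<1+B
  where
  extend : (∀ c → c < B → P c) → P B → ∀ c → Dec (c ≡ B) → c < suc B → P c
  extend below top c (yes refl) _     = top
  extend below top c (no c≢B)   c<1+B = below c (≤∧≢⇒< (≤-pred c<1+B) c≢B)

¬¬-∀Below : ∀ B r {P : Vec ℕ r → Set} → (∀ w → Below B w → ¬ ¬ P w) →
            ¬ ¬ (∀ w → Below B w → P w)
¬¬-∀Below B zero    hyp = do
  p ← hyp [] []
  pure λ { [] [] → p }
¬¬-∀Below B (suc r) hyp = do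
  f ← ¬¬-∀< B (λ c c<B → ¬¬-∀Below B r (λ w w<B → hyp (c ∷ w) (c<B ∷ w<B)))
  pure λ { (c ∷ w) (c<B ∷ w<B) → f c c<B w w<B }

-- x₀ is the junk value taken outside [0, B)ʳ.
¬¬-choiceBelow : ∀ B r {X : Set} → X → (R : Vec ℕ r → X → Set) →
                 (∀ w → Below B w → ¬ ¬ Σ X (R w)) →
                 ¬ ¬ Σ (Vec ℕ r → X) (λ h → ∀ w → Below B w → R w (h w))
¬¬-choiceBelow B r {X} x₀ R hyp = do
  f ← ¬¬-∀Below B r hyp
  pure (choose f , choose-spec f)
  where
  choose : (∀ w → Below B w → Σ X (R w)) → Vec ℕ r → X
  choose f w with all? (_<? B) w
  ... | yes w<B = proj₁ (f w w<B)
  ... | no _    = x₀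
  choose-spec : ∀ f w → Below B w → R w (choose f w)
  choose-spec f w w<B with all? (_<? B) w
  ... | yes w<B' = proj₂ (f w w<B')
  ... | no w≮B   = ⊥-elim (w≮B w<B)

≡-same-truth : ∀ {a b c : Bool} → a ≡ c → b ≡ c → (a ≡ true → b ≡ true) × (b ≡ true → a ≡ true)
≡-same-truth a≡c b≡c =
  (λ a≡t → trans b≡c (trans (sym a≡c) a≡t)) , (λ b≡t → trans a≡c (trans (sym b≡c) b≡t))

_Decides_ : {A : Set} → (A → Bool) → (A → Set) → Set
d Decides Q = ∀ w → (d w ≡ true → Q w) × (Q w → d w ≡ true)

¬¬-decideBelow : ∀ B r (Q : Vec ℕ r → Set) →
                 ¬ ¬ Σ (Vec ℕ r → Bool) λ d →
                       ∀ w → Below B w → (d w ≡ true → Q w) × (Q w → d w ≡ true)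
¬¬-decideBelow B r Q = ¬¬-choiceBelow B r false (λ w b → (b ≡ true → Q w) × (Q w → b ≡ true))
  (λ w _ → ¬¬-map decision ¬¬-excluded-middle)
  where
  decision : ∀ {w} → Dec (Q w) → Σ Bool (λ b → (b ≡ true → Q w) × (Q w → b ≡ true))
  decision (yes q) = true , (λ _ → q) , (λ _ → refl)
  decision (no ¬q) = false , (λ ()) , (λ q → ⊥-elim (¬q q))

¬¬-supportedDecision : ∀ {r} L (Q : Vec ℕ r → Set) →
                       (∀ π → FixesBelow L π → ∀ v → Q v → Q (map (to π) v)) →
                       ¬ ¬ Σ (Vec ℕ r → Bool) (λ P → Supported L P × P Decides Q)
¬¬-supportedDecision {r} L Q invariant = do
  (d , d-decides) ← ¬¬-decideBelow (L + r) r Q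
  pure ( d ∘ normalForm L
       , (λ π fix v → cong d (normalForm-invariant π v fix))
       , λ w → let (sound , complete) = d-decides (normalForm L w) (normalForm-< L w) in
               (λ e → invariant⁻¹ (τ w) (normaliser-fixesBelow₀ L w) w (sound e)) ,
               (λ q → complete (invariant (τ w) (normaliser-fixesBelow₀ L w) w q)) )
  where
  τ : Vec ℕ r → Perm
  τ = normaliser L 0
  invariant⁻¹ : ∀ π → FixesBelow L π → ∀ v → Q (map (to π) v) → Q v
  invariant⁻¹ π fix v q = subst Q (map-from-to π v) (invariant (↔-sym π) (fixesBelow-sym π fix) _ q)

vecUpperBound : ℕ → ∀ r → (Vec ℕ r → ℕ) → ℕ
vecUpperBound B zero    h = h []
vecUpperBound B (suc r) h = upperBound B (λ c → vecUpperBound B r (h ∘ (c ∷_)))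

≤-vecUpperBound : ∀ B r h w → Below B w → h w ≤ vecUpperBound B r h
≤-vecUpperBound B zero    h []      []          = ≤-refl
≤-vecUpperBound B (suc r) h (c ∷ w) (c<B ∷ w<B) =
  ≤-trans (≤-vecUpperBound B r (h ∘ (c ∷_)) w w<B)
          (<⇒≤ (<-upperBound B (λ c → vecUpperBound B r (h ∘ (c ∷_))) c<B))

module _ {S : PredStructure} where

  setIs : ∀ {r} → Assignment S → Vec ℕ r → Vec (J0 S) r → Assignment S
  setIs σ []       []       = σ
  setIs σ (x ∷ xs) (d ∷ ds) = setIs (setI σ x d) xs ds

  sat-allIs⁺ : ∀ {r} (σ : Assignment S) (xs : Vec ℕ r) F →
               (∀ ds → sat (setIs σ xs ds) F) → sat σ (allIs xs F)
  sat-allIs⁺ σ []       F h = h []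
  sat-allIs⁺ σ (x ∷ xs) F h d = sat-allIs⁺ (setI σ x d) xs F (h ∘ (d ∷_))

  sat-allIs⁻ : ∀ {r} (σ : Assignment S) (xs : Vec ℕ r) F →
               sat σ (allIs xs F) → ∀ ds → sat (setIs σ xs ds) F
  sat-allIs⁻ σ []       F h []       = h
  sat-allIs⁻ σ (x ∷ xs) F h (d ∷ ds) = sat-allIs⁻ (setI σ x d) xs F (h d) ds

  prd-setIs : ∀ {r} (σ : Assignment S) (xs : Vec ℕ r) ds → prd (setIs σ xs ds) ≡ prd σ
  prd-setIs σ []       []       = refl
  prd-setIs σ (x ∷ xs) (d ∷ ds) = prd-setIs (setI σ x d) xs ds

  setIs-cong : ∀ {r} (σ σ' : Assignment S) (xs : Vec ℕ r) ds j → (j ∈ᵥ xs ⊎ ind σ j ≡ ind σ' j) →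
               ind (setIs σ xs ds) j ≡ ind (setIs σ' xs ds) j
  setIs-cong σ σ' []       []       j (inj₂ e) = e
  setIs-cong σ σ' (x ∷ xs) (d ∷ ds) j h = setIs-cong (setI σ x d) (setI σ' x d) xs ds j (step h)
    where
    step : j ∈ᵥ x ∷ xs ⊎ ind σ j ≡ ind σ' j → j ∈ᵥ xs ⊎ ind (setI σ x d) j ≡ ind (setI σ' x d) j
    step (inj₁ (here j≡x))   = inj₂ (setI-cong x d j (λ j≢x → ⊥-elim (j≢x j≡x)))
    step (inj₁ (there j∈xs)) = inj₁ j∈xs
    step (inj₂ e)            = inj₂ (setI-cong x d j (λ _ → e))

  setIs-∉ : ∀ {r} (σ : Assignment S) (xs : Vec ℕ r) ds j → ¬ j ∈ᵥ xs → ind (setIs σ xs ds) j ≡ ind σ j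
  setIs-∉ σ []       []       j j∉xs = refl
  setIs-∉ σ (x ∷ xs) (d ∷ ds) j j∉xs =
    trans (setIs-∉ (setI σ x d) xs ds j (j∉xs ∘ there)) (setI-other σ d (j∉xs ∘ here))

  setIs-≈ : ∀ {r} {σ σ' : Assignment S} (xs : Vec ℕ r) ds → σ ≈ σ' → setIs σ xs ds ≈ setIs σ' xs ds
  setIs-≈ {σ = σ} {σ'} xs ds eq = record
    { ind-≡ = λ j → setIs-cong σ σ' xs ds j (inj₂ (ind-≡ eq j))
    ; prd-≗ = λ k a v → trans (cong (λ p → proj₁ (p k a) v) (prd-setIs σ xs ds))
                             (trans (prd-≗ eq k a v) (cong (λ p → proj₁ (p k a) v) (sym (prd-setIs σ' xs ds)))) }

  agree-setIs : ∀ {r VI VP} {σ σ' : Assignment S} (xs : Vec ℕ r) ds → Agree VI VP σ σ' →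
                Agree VI VP (setIs σ xs ds) (setIs σ' xs ds)
  agree-setIs {σ = σ} {σ'} xs ds agree = record
    { ind-agree = λ j free → setIs-cong σ σ' xs ds j (inj₂ (ind-agree agree j free))
    ; prd-agree = λ k a free v → trans (cong (λ p → proj₁ (p k a) v) (prd-setIs σ xs ds))
                                       (trans (prd-agree agree k a free v)
                                              (cong (λ p → proj₁ (p k a) v) (sym (prd-setIs σ' xs ds)))) }

  setIs-reassign : ∀ {r} (σ : Assignment S) (xs : Vec ℕ r) ds →
                   setIs σ xs (map (ind (setIs σ xs ds)) xs) ≈ setIs σ xs ds
  setIs-reassign σ []       []       = ≈-refl
  setIs-reassign σ (x ∷ xs) (d ∷ ds) =
    ≈-trans first (setIs-reassign σ₁ xs ds)
    where
    σ₁ = setI σ x d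
    σ' = setI σ x (ind (setIs σ₁ xs ds) x)
    w  = map (ind (setIs σ₁ xs ds)) xs
    reassigned : ∀ j → Dec (j ∈ᵥ xs) → Dec (j ≡ x) → j ∈ᵥ xs ⊎ ind σ' j ≡ ind σ₁ j
    reassigned j (yes j∈xs) _        = inj₁ j∈xs
    reassigned j (no j∉xs)  (yes refl) = inj₂ (trans (setI-same σ j _) (setIs-∉ σ₁ xs ds j j∉xs))
    reassigned j (no _)     (no j≢x) = inj₂ (trans (setI-other σ _ j≢x) (sym (setI-other σ d j≢x)))
    first : setIs σ' xs w ≈ setIs σ₁ xs w
    first = record
      { ind-≡ = λ j → setIs-cong σ' σ₁ xs w j (reassigned j (j ∈? xs) (j ≟ x))
      ; prd-≗ = λ k a v → cong (λ p → proj₁ (p k a) v) (trans (prd-setIs σ' xs w) (sym (prd-setIs σ₁ xs w))) }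

  agreeOn-setP-fresh : ∀ {k a} F (ρ : Assignment S) (P : Pred S k) → ¬ OccursP k a F →
                       AgreeOn F (setP ρ k a P) ρ
  agreeOn-setP-fresh {k} {a} F ρ P fresh = record
    { ind-agree = λ _ _ → refl
    ; prd-agree = λ k' a' free v →
        cong (λ R → proj₁ R v) (setP-other ρ P (λ { (refl , refl) → fresh (freeP⇒occursP k a F free) })) }

  setIs-vars-below : ∀ s r (σ : Assignment S) w j → j < s → ind (setIs σ (vars s r) w) j ≡ ind σ j
  setIs-vars-below s zero    σ []      j j<s = refl
  setIs-vars-below s (suc r) σ (d ∷ w) j j<s =
    trans (setIs-vars-below (suc s) r (setI σ s d) w j (m<n⇒m<1+n j<s)) (setI-other σ d (<⇒≢ j<s))

  map-setIs-vars : ∀ s r (σ : Assignment S) w → map (ind (setIs σ (vars s r) w)) (vars s r) ≡ w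
  map-setIs-vars s zero    σ []      = refl
  map-setIs-vars s (suc r) σ (d ∷ w) =
    cong₂ _∷_ (trans (setIs-vars-below (suc s) r (setI σ s d) w s (n<1+n s)) (setI-same σ s d))
              (map-setIs-vars (suc s) r (setI σ s d) w)

∈-vars : ∀ s r {j} → s ≤ j → j < s + r → j ∈ᵥ vars s r
∈-vars s zero    {j} s≤j j<s+0 = ⊥-elim (<⇒≱ j<s+0 (subst (_≤ j) (sym (+-identityʳ s)) s≤j))
∈-vars s (suc r) {j} s≤j j<s+1+r with j ≟ s
... | yes j≡s = here j≡s
... | no j≢s  = there (∈-vars (suc s) r (≤∧≢⇒< s≤j (j≢s ∘ sym)) (subst (j <_) (+-suc s r) j<s+1+r))

∈-vars⁻ : ∀ s r {j} → j ∈ᵥ vars s r → j < s + r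
∈-vars⁻ s (suc r) (here refl)  = m<m+n _ (s≤s z≤n)
∈-vars⁻ s (suc r) {j} (there j∈vs) = subst (j <_) (sym (+-suc s r)) (∈-vars⁻ (suc s) r j∈vs)

-- Comprehension

comprehension-witness : ∀ {S : PredStructure} k a (xs : Vec ℕ (suc k)) H (ρ : Assignment S) (P : Pred S k) →
                        ¬ OccursP k a H → proj₁ P Decides (λ v → sat (setIs ρ xs v) H) →
                        ∀ ds → sat (setIs (setP ρ k a P) xs ds) (app k a xs ⇔' H)
comprehension-witness k a xs H ρ P fresh decides ds =
  (λ e → fromQ (proj₁ (decides u) (trans (sym appEq) e))) , (λ s → trans appEq (proj₂ (decides u) (toQ s)))
  where
  σ  = setIs (setP ρ k a P) xs ds
  σ₀ = setIs ρ xs ds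
  u  = map (ind σ₀) xs
  appEq : proj₁ (prd σ k a) (map (ind σ) xs) ≡ proj₁ P u
  appEq = cong₂ proj₁ (trans (cong (λ p → p k a) (prd-setIs (setP ρ k a P) xs ds)) (setP-same ρ k a P))
                      (map-cong (λ j → setIs-cong (setP ρ k a P) ρ xs ds j (inj₂ refl)) xs)
  σ≈σ₀ : AgreeOn H σ σ₀
  σ≈σ₀ = agree-setIs xs ds (agreeOn-setP-fresh H ρ P fresh)
  fromQ : sat (setIs ρ xs u) H → sat σ H
  fromQ q = sat-coincide H (agree-sym σ≈σ₀) (sat-≈ H (setIs-reassign ρ xs ds) q)
  toQ : sat σ H → sat (setIs ρ xs u) H
  toQ s = sat-≈ H (≈-sym (setIs-reassign ρ xs ds)) (sat-coincide H σ≈σ₀ s)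

permuteEnv-setIs : ∀ {r} (π : Perm) ρ (xs : Vec ℕ r) v →
                   permuteEnv π (setIs ρ xs v) ≈ setIs (permuteEnv π ρ) xs (map (to π) v)
permuteEnv-setIs π ρ []       []      = ≈-refl
permuteEnv-setIs π ρ (x ∷ xs) (d ∷ v) =
  ≈-trans (permuteEnv-setIs π (setI ρ x d) xs v) (setIs-≈ xs (map (to π) v) (permuteEnv-setI π ρ x d))

maxOf : ∀ {r} → Vec ℕ r → ℕ
maxOf []      = 0
maxOf (x ∷ v) = suc x ⊔ maxOf v

∈⇒<maxOf : ∀ {r} {x} (v : Vec ℕ r) → x ∈ᵥ v → x < maxOf v
∈⇒<maxOf (y ∷ v) (here refl)  = m≤m⊔n (suc y) (maxOf v)
∈⇒<maxOf (y ∷ v) (there x∈v) = <-≤-trans (∈⇒<maxOf v x∈v) (m≤n⊔m (suc y) (maxOf v))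

parameterBound : Env → Formula → ℕ
parameterBound ρ (eqI i j)    = suc (ind ρ i) ⊔ suc (ind ρ j)
parameterBound ρ (eqP k a b)  = support (prd ρ k a) ⊔ support (prd ρ k b)
parameterBound ρ (app k a xs) = support (prd ρ k a) ⊔ maxOf (map (ind ρ) xs)
parameterBound ρ falsum       = 0
parameterBound ρ (neg F)      = parameterBound ρ F
parameterBound ρ (F ∧' G)     = parameterBound ρ F ⊔ parameterBound ρ G
parameterBound ρ (F ∨' G)     = parameterBound ρ F ⊔ parameterBound ρ G
parameterBound ρ (F ⇒' G)     = parameterBound ρ F ⊔ parameterBound ρ G
parameterBound ρ (F ⇔' G)     = parameterBound ρ F ⊔ parameterBound ρ G
parameterBound ρ (allI _ F)   = parameterBound ρ F
parameterBound ρ (exI _ F)    = parameterBound ρ F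
parameterBound ρ (allP _ _ F) = parameterBound ρ F
parameterBound ρ (exP _ _ F)  = parameterBound ρ F

⊔-bound : ∀ {A B : Set} {x m n} → (A → x ≤ m) → (B → x ≤ n) → A ⊎ B → x ≤ m ⊔ n
⊔-bound {m = m} {n} x≤m x≤n = [ m≤n⇒m≤n⊔o n ∘ x≤m , m≤n⇒m≤o⊔n m ∘ x≤n ]′

ind<parameterBound : ∀ ρ F {j} → FreeI j F → ind ρ j < parameterBound ρ F
ind<parameterBound ρ (eqI i j)    (inj₁ refl) = m≤m⊔n (suc (ind ρ i)) (suc (ind ρ j))
ind<parameterBound ρ (eqI i j)    (inj₂ refl) = m≤n⊔m (suc (ind ρ i)) (suc (ind ρ j))
ind<parameterBound ρ (app k a xs) j∈xs =
  m≤n⇒m≤o⊔n (support (prd ρ k a)) (∈⇒<maxOf _ (∈-map⁺ (ind ρ) j∈xs))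
ind<parameterBound ρ (neg F)      = ind<parameterBound ρ F
ind<parameterBound ρ (F ∧' G)     = ⊔-bound (ind<parameterBound ρ F) (ind<parameterBound ρ G)
ind<parameterBound ρ (F ∨' G)     = ⊔-bound (ind<parameterBound ρ F) (ind<parameterBound ρ G)
ind<parameterBound ρ (F ⇒' G)     = ⊔-bound (ind<parameterBound ρ F) (ind<parameterBound ρ G)
ind<parameterBound ρ (F ⇔' G)     = ⊔-bound (ind<parameterBound ρ F) (ind<parameterBound ρ G)
ind<parameterBound ρ (allI _ F)   = ind<parameterBound ρ F ∘ proj₂
ind<parameterBound ρ (exI _ F)    = ind<parameterBound ρ F ∘ proj₂
ind<parameterBound ρ (allP _ _ F) = ind<parameterBound ρ F
ind<parameterBound ρ (exP _ _ F)  = ind<parameterBound ρ F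

support≤parameterBound : ∀ ρ F {k a} → FreeP k a F → support (prd ρ k a) ≤ parameterBound ρ F
support≤parameterBound ρ (eqP k a b)  (inj₁ (refl , refl)) = m≤m⊔n (support (prd ρ k a)) (support (prd ρ k b))
support≤parameterBound ρ (eqP k a b)  (inj₂ (refl , refl)) = m≤n⊔m (support (prd ρ k a)) (support (prd ρ k b))
support≤parameterBound ρ (app k a xs) (refl , refl)        = m≤m⊔n (support (prd ρ k a)) (maxOf (map (ind ρ) xs))
support≤parameterBound ρ (neg F)      = support≤parameterBound ρ F
support≤parameterBound ρ (F ∧' G)     = ⊔-bound (support≤parameterBound ρ F) (support≤parameterBound ρ G)
support≤parameterBound ρ (F ∨' G)     = ⊔-bound (support≤parameterBound ρ F) (support≤parameterBound ρ G)
support≤parameterBound ρ (F ⇒' G)     = ⊔-bound (support≤parameterBound ρ F) (support≤parameterBound ρ G)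
support≤parameterBound ρ (F ⇔' G)     = ⊔-bound (support≤parameterBound ρ F) (support≤parameterBound ρ G)
support≤parameterBound ρ (allI _ F)   = support≤parameterBound ρ F
support≤parameterBound ρ (exI _ F)    = support≤parameterBound ρ F
support≤parameterBound ρ (allP _ _ F) = support≤parameterBound ρ F ∘ proj₂
support≤parameterBound ρ (exP _ _ F)  = support≤parameterBound ρ F ∘ proj₂

permuteEnv-agreeOn : ∀ (π : Perm) ρ F → FixesBelow (parameterBound ρ F) π → AgreeOn F (permuteEnv π ρ) ρ
permuteEnv-agreeOn π ρ F fix = record
  { ind-agree = λ j free → fix (ind ρ j) (ind<parameterBound ρ F free)
  ; prd-agree = λ k a free → support-supported (prd ρ k a) (↔-sym π)
                               (fixesBelow-mono (↔-sym π) (support≤parameterBound ρ F free) (fixesBelow-sym π fix)) }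

isHenkin : IsHenkin supportModel
isHenkin k a xs H fresh ρ = do
  (P , P-supported , P-decides) ← ¬¬-supportedDecision L Q Q-invariant
  let P̂ = P , L , P-supported
  pure (P̂ , sat-allIs⁺ (setP ρ k a P̂) xs (app k a xs ⇔' H) (comprehension-witness k a xs H ρ P̂ fresh P-decides))
  where
  L = parameterBound ρ H
  Q : Vec ℕ (suc k) → Set
  Q v = sat (setIs ρ xs v) H
  Q-invariant : ∀ π → FixesBelow L π → ∀ v → Q v → Q (map (to π) v)
  Q-invariant π fix v q =
    sat-coincide H (agree-setIs xs (map (to π) v) (permuteEnv-agreeOn π ρ H fix))
                   (sat-≈ H (permuteEnv-setIs π ρ xs v) (sat-permute H π q))

-- Choice

unbindI : ∀ {n i j BI} → j ≢ i → j ∈ₗ i ∷ BI ⊎ j < n → j ∈ₗ BI ⊎ j < n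
unbindI j≢i (inj₁ (here j≡i))   = ⊥-elim (j≢i j≡i)
unbindI j≢i (inj₁ (there j∈BI)) = inj₁ j∈BI
unbindI j≢i (inj₂ j<n)          = inj₂ j<n

unbindP : ∀ {D : Set} {k a k' a' : ℕ} {BP : List (ℕ × ℕ)} → ¬ (k' ≡ k × a' ≡ a) →
          (k' , a') ∈ₗ (k , a) ∷ BP ⊎ D → (k' , a') ∈ₗ BP ⊎ D
unbindP ka≢ (inj₁ (here refl)) = ⊥-elim (ka≢ (refl , refl))
unbindP ka≢ (inj₁ (there ∈BP)) = inj₁ ∈BP
unbindP ka≢ (inj₂ isD)         = inj₂ isD

admissible-freeI : ∀ {n m BI BP} H → AdmissibleIn n m BI BP H → ∀ {j} → FreeI j H → j ∈ₗ BI ⊎ j < n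
admissible-freeI (eqI i j)    (i-ok , j-ok) (inj₁ refl)  = i-ok
admissible-freeI (eqI i j)    (i-ok , j-ok) (inj₂ refl)  = j-ok
admissible-freeI (app k a xs) (_ , xs-ok)   j∈xs         = All.lookup xs-ok j∈xs
admissible-freeI (neg F)      adm           = admissible-freeI F adm
admissible-freeI (F ∧' G)     (admF , admG) = [ admissible-freeI F admF , admissible-freeI G admG ]′
admissible-freeI (F ∨' G)     (admF , admG) = [ admissible-freeI F admF , admissible-freeI G admG ]′
admissible-freeI (F ⇒' G)     (admF , admG) = [ admissible-freeI F admF , admissible-freeI G admG ]′
admissible-freeI (F ⇔' G)     (admF , admG) = [ admissible-freeI F admF , admissible-freeI G admG ]′
admissible-freeI (allI i F)   (_ , adm)     (j≢i , free) = unbindI j≢i (admissible-freeI F adm free)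
admissible-freeI (exI i F)    (_ , adm)     (j≢i , free) = unbindI j≢i (admissible-freeI F adm free)
admissible-freeI (allP k a F) (_ , adm)     = admissible-freeI F adm
admissible-freeI (exP k a F)  (_ , adm)     = admissible-freeI F adm

admissible-freeP : ∀ {n m BI BP} H → AdmissibleIn n m BI BP H → ∀ {k a} → FreeP k a H →
                   (k , a) ∈ₗ BP ⊎ (k ≡ m ∸ 1 × a ≡ 0)
admissible-freeP (eqP k b c)  (b-ok , c-ok) (inj₁ (refl , refl)) = b-ok
admissible-freeP (eqP k b c)  (b-ok , c-ok) (inj₂ (refl , refl)) = c-ok
admissible-freeP (app k a xs) (a-ok , _)    (refl , refl)        = a-ok
admissible-freeP (neg F)      adm           = admissible-freeP F adm
admissible-freeP (F ∧' G)     (admF , admG) = [ admissible-freeP F admF , admissible-freeP G admG ]′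
admissible-freeP (F ∨' G)     (admF , admG) = [ admissible-freeP F admF , admissible-freeP G admG ]′
admissible-freeP (F ⇒' G)     (admF , admG) = [ admissible-freeP F admF , admissible-freeP G admG ]′
admissible-freeP (F ⇔' G)     (admF , admG) = [ admissible-freeP F admF , admissible-freeP G admG ]′
admissible-freeP (allI _ F)   (_ , adm)     = admissible-freeP F adm
admissible-freeP (exI _ F)    (_ , adm)     = admissible-freeP F adm
admissible-freeP (allP k a F) (_ , adm)     (ka≢ , free) = unbindP ka≢ (admissible-freeP F adm free)
admissible-freeP (exP k a F)  (_ , adm)     (ka≢ , free) = unbindP ka≢ (admissible-freeP F adm free)

agreeOn-admissible : ∀ {S : PredStructure} {n m} H → Admissible n (suc m) H → {σ σ' : Assignment S} →
                     (∀ j → j < n → ind σ j ≡ ind σ' j) → proj₁ (prd σ m 0) ≗ proj₁ (prd σ' m 0) →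
                     AgreeOn H σ σ'
agreeOn-admissible H adm {σ} {σ'} indAgree prdAgree = record
  { ind-agree = λ j free → [ (λ ()) , indAgree j ]′ (admissible-freeI H adm free)
  ; prd-agree = λ k a free → [ (λ ()) , (λ { (refl , refl) → prdAgree }) ]′ (admissible-freeP H adm free) }

take-++ : ∀ {A : Set} {n m} (x : Vec A n) (y : Vec A m) → take n (x ++ y) ≡ x
take-++ {n = n} x y = ++-injectiveˡ (take n (x ++ y)) x (take++drop≡id n (x ++ y))

drop-++ : ∀ {A : Set} {n m} (x : Vec A n) (y : Vec A m) → drop n (x ++ y) ≡ y
drop-++ {n = n} x y = ++-injectiveʳ (take n (x ++ y)) x (take++drop≡id n (x ++ y))

module Choice (n' m' : ℕ) (H : Formula) (adm : Admissible (suc n') (suc m') H) (ρ : Env) where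

  n  = suc n'
  m  = suc m'
  sk = n' + m
  xs = vars 0 n
  ys = vars n m

  sk≢m' : ¬ (sk ≡ m' × 0 ≡ 0)
  sk≢m' (sk≡m' , _) = <⇒≢ (subst (m' <_) (sym (+-suc n' m')) (s≤s (m≤n+m m' n'))) (sym sk≡m')

  Holds : Env → Vec ℕ n → SPred m' → Set
  Holds σ x D = sat (setP (setIs σ xs x) m' 0 D) H

  holds-transfer : ∀ σ σ' x {D D' : SPred m'} → proj₁ D ≗ proj₁ D' → Holds σ x D → Holds σ' x D'
  holds-transfer σ σ' x {D} {D'} D≗D' = sat-coincide H (agreeOn-admissible H adm
    (λ j j<n → setIs-cong σ σ' xs x j (inj₁ (∈-vars 0 n z≤n j<n)))
    (λ v → trans (cong (λ R → proj₁ R v) (setP-same (setIs σ xs x) m' 0 D))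
                 (trans (D≗D' v) (cong (λ R → proj₁ R v) (sym (setP-same (setIs σ' xs x) m' 0 D'))))))

  holds-permute : ∀ (π : Perm) x D → Holds ρ x D → Holds ρ (map (to π) x) (permute π D)
  holds-permute π x D holds =
    holds-transfer (permuteEnv π ρ) ρ (map (to π) x) {permute π D} (λ _ → refl)
      (sat-≈ H (≈-trans (permuteEnv-setP π (setIs ρ xs x) m' 0 D)
                        (setP-≈ 0 (permuteEnv-setIs π ρ xs x) (λ _ → refl)))
               (sat-permute H π holds))

  holds-normalise : ∀ L x D → Holds ρ (normalForm L x) D → Holds ρ x (permute (↔-sym (normaliser L 0 x)) D)
  holds-normalise L x D holds =
    subst (λ z → Holds ρ z (permute (↔-sym τ) D)) (map-from-to τ x)
          (holds-permute (↔-sym τ) (normalForm L x) D holds)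
    where
    τ : Perm
    τ = normaliser L 0 x

  -- chosen is only given on [0, n)ⁿ. Normalising x relative to 0 reaches that region, but the S
  -- built that way need not be finitely supported; so x is first normalised relative to the common
  -- bound L of the supports of the choices, and the result is then normalised relative to 0.
  module Construction (chosen : Vec ℕ n → SPred m') (chosen-holds : ∀ c → Below n c → Holds ρ c (chosen c)) where

    L : ℕ
    L = vecUpperBound n n (support ∘ chosen)

    transported : Vec ℕ n → SPred m'
    transported c = permute (↔-sym (normaliser 0 0 c)) (chosen (normalForm 0 c))

    transported-holds : ∀ c → Holds ρ c (transported c)
    transported-holds c = holds-normalise 0 c (chosen (normalForm 0 c)) (chosen-holds (normalForm 0 c) (normalForm-< 0 c))

    transported-supported : ∀ {B} c → Below B c → L ≤ B → Supported B (proj₁ (transported c))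
    transported-supported {B} c c<B L≤B ψ ψ-fixes y =
      trans (cong (proj₁ (chosen c₀)) (map-conjugate (↔-sym τ) ψ y))
            (support-supported (chosen c₀) χ χ-fixes (map (to τ) y))
      where
      τ  = normaliser 0 0 c
      c₀ = normalForm 0 c
      χ  = conjugate (↔-sym τ) ψ
      χ-fixes : FixesBelow (support (chosen c₀)) χ
      χ-fixes a a<supp =
        trans (cong (to τ) (ψ-fixes (from τ a) (normaliser-from-< 0 0 c c<B a<B))) (strictlyInverseˡ τ a)
        where
        a<B = <-≤-trans a<supp (≤-trans (≤-vecUpperBound n n (support ∘ chosen) c₀ (normalForm-< 0 c)) L≤B)

    section : Vec ℕ n → SPred m'
    section x = permute (↔-sym (normaliser L 0 x)) (transported (normalForm L x))

    section-holds : ∀ x → Holds ρ x (section x)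
    section-holds x = holds-normalise L x (transported (normalForm L x)) (transported-holds (normalForm L x))

    section-supported : ∀ π → FixesBelow L π → ∀ x y →
                        proj₁ (section (map (to π) x)) (map (to π) y) ≡ proj₁ (section x) y
    section-supported π fix x y = begin
      proj₁ (transported (normalForm L (map (to π) x))) (map (to τπ) (map (to π) y))
        ≡⟨ cong (λ c → proj₁ (transported c) (map (to τπ) (map (to π) y))) (normalForm-invariant π x fix) ⟩
      proj₁ (transported (normalForm L x)) (map (to τπ) (map (to π) y))
        ≡⟨ cong (proj₁ (transported (normalForm L x))) (map-normalisedTwist L 0 π x y) ⟩
      proj₁ (transported (normalForm L x)) (map (to ψ) (map (to τ) y))
        ≡⟨ transported-supported (normalForm L x) (normaliser-< L 0 x) (m≤m+n L _) ψ ψ-fixes (map (to τ) y) ⟩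
      proj₁ (transported (normalForm L x)) (map (to τ) y)
        ∎
      where
      open ≡-Reasoning
      τ  = normaliser L 0 x
      τπ = normaliser L 0 (map (to π) x)
      ψ  = normalisedTwist L 0 π x
      ψ-fixes = proj₂ (normaliser-equivariant L 0 π x (fixesBelow-+0 π fix))

    graph : Vec ℕ (n + m) → Bool
    graph v = proj₁ (section (take n v)) (drop n v)

    graph-supported : Supported L graph
    graph-supported π fix v =
      trans (cong₂ (λ x y → proj₁ (section x) y) (take-map (to π) n v) (drop-map (to π) n v))
            (section-supported π fix (take n v) (drop n v))

    graph-++ : ∀ x y → graph (x ++ y) ≡ proj₁ (section x) y
    graph-++ x y = cong₂ (λ x y → proj₁ (section x) y) (take-++ x y) (drop-++ x y)

    Ŝ : SPred sk
    Ŝ = graph , L , graph-supported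

    module _ (x : Vec ℕ n) where

      σ : Env
      σ = setP (setIs (setP ρ sk 0 Ŝ) xs x) m' 0 (section x)

      section-holds-in-σ : sat σ H
      section-holds-in-σ = holds-transfer ρ (setP ρ sk 0 Ŝ) x (λ _ → refl) (section-holds x)

      σ[_] : Vec ℕ m → Env
      σ[ y ] = setIs σ ys y

      D-at : ∀ y → proj₁ (prd σ[ y ] m' 0) (map (ind σ[ y ]) ys) ≡ proj₁ (section x) y
      D-at y = cong₂ proj₁ (trans (cong (λ p → p m' 0) (prd-setIs σ ys y)) (setP-same _ m' 0 (section x)))
                           (map-setIs-vars n m σ y)

      S-at : ∀ y → proj₁ (prd σ[ y ] sk 0) (map (ind σ[ y ]) (xs ++ ys)) ≡ proj₁ (section x) y
      S-at y = trans (cong₂ proj₁ S-is-Ŝ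
                            (trans (map-++ (ind σ[ y ]) xs ys) (cong₂ _++_ xs↦x (map-setIs-vars n m σ y))))
                     (graph-++ x y)
        where
        S-is-Ŝ : prd σ[ y ] sk 0 ≡ Ŝ
        S-is-Ŝ = begin
          prd σ[ y ] sk 0                        ≡⟨ cong (λ p → p sk 0) (prd-setIs σ ys y) ⟩
          prd σ sk 0                             ≡⟨ setP-other _ (section x) sk≢m' ⟩
          prd (setIs (setP ρ sk 0 Ŝ) xs x) sk 0  ≡⟨ cong (λ p → p sk 0) (prd-setIs (setP ρ sk 0 Ŝ) xs x) ⟩
          prd (setP ρ sk 0 Ŝ) sk 0               ≡⟨ setP-same ρ sk 0 Ŝ ⟩
          Ŝ                                      ∎
          where open ≡-Reasoning
        xs↦x : map (ind σ[ y ]) xs ≡ x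
        xs↦x = trans (map-agree {S = supportModel} _ _ xs
                                (λ j j∈xs → setIs-vars-below n m σ y j (∈-vars⁻ 0 n j∈xs)))
                     (map-setIs-vars 0 n (setP ρ sk 0 Ŝ) x)

      section-is-fibre : sat σ (allIs ys (app m' 0 ys ⇔' app sk 0 (xs ++ ys)))
      section-is-fibre = sat-allIs⁺ σ ys _ λ y → ≡-same-truth (D-at y) (S-at y)

  choice-holds : sat ρ (choice n m H)
  choice-holds premise = do
    (chosen , chosen-holds) ← ¬¬-choiceBelow n n (Mem-inh supportModel m') (Holds ρ)
                                (λ c _ → sat-allIs⁻ ρ xs (exP m' 0 H) premise c)
    let open Construction chosen chosen-holds
    pure (Ŝ , sat-allIs⁺ (setP ρ sk 0 Ŝ) xs _ λ x → pure (section x , section-is-fibre x , section-holds-in-σ x))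

-- Failure of WO¹

supported-swap : ∀ {L a b} {P : Vec ℕ 2 → Bool} → Supported L P → L ≤ a → L ≤ b →
                 P (a ∷ b ∷ []) ≡ P (b ∷ a ∷ [])
supported-swap {L} {a} {b} {P} supp L≤a L≤b =
  trans (sym (supp (transposition a b) (transposition-fixesBelow L≤a L≤b) (a ∷ b ∷ [])))
        (cong₂ (λ x y → P (x ∷ y ∷ [])) (transpose-left a b) (transpose-right a b))

notWO : supportModel ⊨ neg WO1
notWO ρ wo = wo everything noStrictWellOrder
  where
  everything : SPred 0
  everything = (λ _ → true) , 0 , λ _ _ _ → refl
  noStrictWellOrder : ¬ Σ (SPred 1) (λ T → sat (setP (setP ρ 0 0 everything) 1 0 T) (strictLinOnA ∧' leastElements))
  noStrictWellOrder (T , (irreflexive , transitive , linear) , _) =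
    linear a b (refl , refl) λ
      { (inj₁ Tab)        → cyclic Tab
      ; (inj₂ a≡b⊎Tba) → a≡b⊎Tba λ
          { (inj₁ a≡b) → a≡b (1+n≢n ∘ sym)
          ; (inj₂ Tba) → cyclic (trans T-symmetric Tba) } }
    where
    a = support T
    b = suc a
    T-symmetric : proj₁ T (a ∷ b ∷ []) ≡ proj₁ T (b ∷ a ∷ [])
    T-symmetric = supported-swap (support-supported T) ≤-refl (n≤1+n a)
    cyclic : proj₁ T (a ∷ b ∷ []) ≡ true → ⊥
    cyclic Tab = irreflexive a refl (transitive a b a (refl , refl , refl , Tab , trans (sym T-symmetric) Tab))

proposition4p2 : (n m : ℕ) → 1 ≤ n → 1 ≤ m →
    Σ PredStructure (λ S →
      IsHenkin S
      × ((H : Formula) → Admissible n m H → S ⊨ choice n m H)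
      × S ⊨ neg WO1)
proposition4p2 (suc n') (suc m') _ _ = supportModel , isHenkin , (λ H adm ρ → Choice.choice-holds n' m' H adm ρ) , notWO
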